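{- Let $n>1$ be an integer every prime divisor of which is at least $7$, and $A=U(n)^2$. If $S$ is an $A$-extremal sequence in $\mathbb{Z}_n$, then every prime divisor $q$ of $n$ is coprime to at least two terms of $S$.
   Context: $\mathbb{Z}_n=\mathbb{Z}/n\mathbb{Z}$, $U(n)$ its group of units, $U(n)^2=\{x^2:x\in U(n)\}$. A sequence $(x_1,\ldots,x_k)$ ($k\ge1$) in $\mathbb{Z}_n$ is an $A$-weighted zero-sum sequence if there exist $a_1,\ldots,a_k\in A$ with $a_1x_1+\cdots+a_kx_k=0$. A subsequence of consecutive terms is a nonempty block $(x_i,\ldots,x_j)$. $C_A(n)$ is the least positive integer $k$ such that every sequence of length $k$ in $\mathbb{Z}_n$ has an $A$-weighted zero-sum subsequence of consecutive terms. A sequence in $\mathbb{Z}_n$ is $A$-extremal if it has length $C_A(n)-1$ and has no $A$-weighted zero-sum subsequence of consecutive terms. A prime $q\mid n$ is coprime to $x\in\mathbb{Z}_n$ if $q$ does not divide the integer representatives of $x$. -}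

module Defs where

open import Data.Nat using (ℕ; zero; suc; _+_; _*_; _%_; _<_; _≤_; NonZero)
open import Data.Nat.Divisibility using (_∣_)
open import Data.Nat.Coprimality using (Coprime)
open import Data.Nat.Primality using (Prime)
open import Data.Fin using (Fin; toℕ)
open import Data.List using (List; []; _∷_; _++_; length)
open import Data.List.Relation.Unary.All using (All)
open import Data.Product using (Σ; ∃; _×_; _,_)
open import Relation.Binary.PropositionalEquality using (_≡_)
open import Relation.Nullary using (¬_)

-- Elements of ℤ_n are represented by Fin n (canonical residues 0..n-1).

UnitSquare : (n : ℕ) .{{_ : NonZero n}} → Fin n → Set
UnitSquare n a = Σ ℕ λ u → u < n × Coprime u n × toℕ a ≡ (u * u) % n

weightedSum : {n : ℕ} → List (Fin n) → List (Fin n) → ℕ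
weightedSum (a ∷ as) (x ∷ xs) = toℕ a * toℕ x + weightedSum as xs
weightedSum _ _ = 0

WeightedZeroSum : (n : ℕ) .{{_ : NonZero n}} → List (Fin n) → Set
WeightedZeroSum n xs =
  Σ (List (Fin n)) λ as →
    length as ≡ length xs × All (UnitSquare n) as × weightedSum as xs % n ≡ 0

HasConsecZeroSum : (n : ℕ) .{{_ : NonZero n}} → List (Fin n) → Set
HasConsecZeroSum n xs =
  Σ (List (Fin n)) λ pre → Σ (Fin n) λ b → Σ (List (Fin n)) λ bs → Σ (List (Fin n)) λ post →
    xs ≡ pre ++ (b ∷ bs) ++ post × WeightedZeroSum n (b ∷ bs)

EveryLengthHas : (n : ℕ) .{{_ : NonZero n}} → ℕ → Set
EveryLengthHas n k = (xs : List (Fin n)) → length xs ≡ k → HasConsecZeroSum n xs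

IsCA : (n : ℕ) .{{_ : NonZero n}} → ℕ → Set
IsCA n C = 1 ≤ C × EveryLengthHas n C × ((m : ℕ) → 1 ≤ m → m < C → ¬ EveryLengthHas n m)

Extremal : (n : ℕ) .{{_ : NonZero n}} → List (Fin n) → Set
Extremal n S = Σ ℕ λ C → IsCA n C × length S + 1 ≡ C × ¬ HasConsecZeroSum n S

PrimeCoprimeTo : {n : ℕ} → ℕ → Fin n → Set
PrimeCoprimeTo q x = ¬ (q ∣ toℕ x)

AtLeastTwoCoprime : {n : ℕ} → ℕ → List (Fin n) → Set
AtLeastTwoCoprime q S =
  Σ _ λ pre → Σ _ λ x → Σ _ λ mid → Σ _ λ y → Σ _ λ post →
    S ≡ pre ++ x ∷ mid ++ y ∷ post × PrimeCoprimeTo q x × PrimeCoprimeTo q y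

{-# OPTIONS --safe #-}
-- Suppose q divides every term of S except at most one, x (put x = 1 if there is none).
-- Let t be a quadratic non-residue mod q (one exists since q ≥ 3) and append to S a term
-- y ≡ −x t (mod q).  The longer sequence has a zero-sum block, which must be a suffix B y;
-- modulo q only x and y survive in it, so b y ≡ 0 or a x + b y ≡ 0 with a ≡ u², b ≡ v²
-- and v invertible.  Either way x (u² − v² t) ≡ 0 for some u, whence t ≡ (u/v)².
module Submission where

open import Data.Nat
open import Data.Nat.Properties hiding (<⇒≢)
open import Data.Nat.DivMod
open import Data.Nat.Divisibility
open import Data.Nat.Coprimality using (Coprime; coprime-Bézout)
open import Data.Nat.GCD using (module Bézout)
open import Data.Nat.Primality using (Prime; euclidsLemma; prime⇒nonZero)
open import Data.Nat.Tactic.RingSolver using (solve-∀)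
open import Data.Fin using (Fin; toℕ; fromℕ<) renaming (_<_ to _<ᶠ_)
open import Data.Fin.Properties using (toℕ<n; toℕ-fromℕ<; toℕ-injective; <⇒≢; any?; all?; ¬∀⟶∃¬; pigeonhole)
open import Data.Empty using (⊥; ⊥-elim)
open import Data.Product using (∃; ∃₂; _×_; _,_; proj₁; proj₂)
open import Data.Sum using (_⊎_; inj₁; inj₂)
open import Relation.Nullary using (¬_; yes; no; ¬?)
open import Relation.Nullary.Decidable using (decidable-stable; toSum)
open import Relation.Binary.PropositionalEquality using (_≡_; _≢_; refl; sym; trans; cong; cong₂; subst; module ≡-Reasoning)
open import Data.List using (List; []; _∷_; _++_; [_]; length)
open import Data.List.Properties using (++-assoc; ++-conicalʳ; ∷-injective; ∷-injectiveʳ; ++-identityʳ; length-++)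
open import Data.List.Relation.Unary.All using (All; []; _∷_)
open import Data.List.Relation.Unary.All.Properties using (++⁻ʳ)
open import Data.List.Relation.Unary.First using (first; module FirstView)
open import Data.List.Relation.Unary.First.Properties using (toView)
open import Defs

NonResidue : (d : ℕ) .{{_ : NonZero d}} → ℕ → Set
NonResidue d t = ∀ s → s * s % d ≢ t % d

module Modulo (d : ℕ) .{{_ : NonZero d}} where

  %-cong-+ : ∀ {a b c e} → a % d ≡ b % d → c % d ≡ e % d → (a + c) % d ≡ (b + e) % d
  %-cong-+ {a} {b} {c} {e} a≡b c≡e = begin
    (a + c) % d             ≡⟨ %-distribˡ-+ a c d ⟩
    (a % d + c % d) % d     ≡⟨ cong₂ (λ m k → (m + k) % d) a≡b c≡e ⟩
    (b % d + e % d) % d     ≡⟨ %-distribˡ-+ b e d ⟨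
    (b + e) % d             ∎
    where open ≡-Reasoning

  %-cong-* : ∀ {a b c e} → a % d ≡ b % d → c % d ≡ e % d → a * c % d ≡ b * e % d
  %-cong-* {a} {b} {c} {e} a≡b c≡e = begin
    a * c % d               ≡⟨ %-distribˡ-* a c d ⟩
    (a % d) * (c % d) % d   ≡⟨ cong₂ (λ m k → m * k % d) a≡b c≡e ⟩
    (b % d) * (e % d) % d   ≡⟨ %-distribˡ-* b e d ⟨
    b * e % d               ∎
    where open ≡-Reasoning

  ∣-resp-%≡ : ∀ {a b} → a % d ≡ b % d → d ∣ a → d ∣ b
  ∣-resp-%≡ {a} {b} a≡b d∣a = m%n≡0⇒n∣m b d (trans (sym a≡b) (n∣m⇒m%n≡0 a d d∣a))

  d∣n+pred[d]*n : ∀ n → d ∣ n + pred d * n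
  d∣n+pred[d]*n n = subst (λ k → d ∣ k * n) (sym (suc-pred d)) (m∣m*n n)

  d∣m+pred[d]*n⇒m%d≡n%d : ∀ m n → d ∣ m + pred d * n → m % d ≡ n % d
  d∣m+pred[d]*n⇒m%d≡n%d m n d∣m-n = begin
    m % d                         ≡⟨ %-remove-+ʳ m (d∣n+pred[d]*n n) ⟨
    (m + (n + pred d * n)) % d    ≡⟨ cong (_% d) (regroup m n (pred d * n)) ⟩
    (m + pred d * n + n) % d      ≡⟨ %-remove-+ˡ n d∣m-n ⟩
    n % d                         ∎
    where
    open ≡-Reasoning
    regroup : ∀ a b c → a + (b + c) ≡ a + c + b
    regroup = solve-∀

  pred[d]*pred[d]%d≡1%d : pred d * pred d % d ≡ 1 % d
  pred[d]*pred[d]%d≡1%d = d∣m+pred[d]*n⇒m%d≡n%d (pred d * pred d) 1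
    (subst (d ∣_) (regroup (pred d)) (d∣n+pred[d]*n (pred d)))
    where
    regroup : ∀ p → p + p * p ≡ p * p + p * 1
    regroup = solve-∀

  coprime⇒∃inverse : ∀ {v} → Coprime v d → ∃ λ w → v * w % d ≡ 1 % d
  coprime⇒∃inverse {v} v⊥d with coprime-Bézout v⊥d
  ... | Bézout.+- x y eq = x , (begin
    v * x % d          ≡⟨ cong (_% d) (trans (*-comm v x) (sym eq)) ⟩
    (1 + y * d) % d    ≡⟨ [m+kn]%n≡m%n 1 y d ⟩
    1 % d              ∎)
    where open ≡-Reasoning
  ... | Bézout.-+ x y eq = x * pred d , d∣m+pred[d]*n⇒m%d≡n%d (v * (x * pred d)) 1
    (subst (d ∣_) (factor v x (pred d)) (∣n⇒∣m*n (pred d) (divides y eq)))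
    where
    factor : ∀ v x p → p * (1 + x * v) ≡ v * (x * p) + p * 1
    factor = solve-∀

  nonResidue-coprimeSquare : ∀ {t u v} → NonResidue d t → Coprime v d → u * u % d ≢ v * v * t % d
  nonResidue-coprimeSquare {t} {u} {v} nr v⊥d u²≡v²t with coprime⇒∃inverse v⊥d
  ... | w , vw≡1 = nr (u * w) (begin
    u * w * (u * w) % d         ≡⟨ cong (_% d) (regroup₁ u w) ⟩
    u * u * (w * w) % d         ≡⟨ %-cong-* u²≡v²t refl ⟩
    v * v * t * (w * w) % d     ≡⟨ cong (_% d) (regroup₂ v w t) ⟩
    v * w * (v * w) * t % d     ≡⟨ %-cong-* (%-cong-* vw≡1 vw≡1) refl ⟩
    1 * 1 * t % d               ≡⟨ cong (_% d) (+-identityʳ t) ⟩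
    t % d                       ∎)
    where
    open ≡-Reasoning
    regroup₁ : ∀ u w → u * w * (u * w) ≡ u * u * (w * w)
    regroup₁ = solve-∀
    regroup₂ : ∀ v w t → v * v * t * (w * w) ≡ v * w * (v * w) * t
    regroup₂ = solve-∀

  root-below-pred : 2 < d → ∀ {s} → s < d → ∃ λ r → r < pred d × r * r % d ≡ s * s % d
  root-below-pred 2<d {s} s<d with s <? pred d
  ... | yes s<pred = s , s<pred , refl
  ... | no s≮pred = 1 , pred-mono-≤ 2<d , (begin
    1 * 1 % d                  ≡⟨ pred[d]*pred[d]%d≡1%d ⟨
    pred d * pred d % d        ≡⟨ cong (λ k → k * k % d) s≡pred ⟨
    s * s % d                  ∎)
    where
    open ≡-Reasoning
    s≡pred : s ≡ pred d
    s≡pred = ≤-antisym (<⇒≤pred s<d) (≮⇒≥ s≮pred)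

  ¬squaring-surjective : 2 < d → ¬ (∀ (t : Fin d) → ∃ λ (s : Fin d) → toℕ s * toℕ s % d ≡ toℕ t)
  ¬squaring-surjective 2<d root = collision (pigeonhole (≤-reflexive (suc-pred d)) smallRoot)
    where
    open ≡-Reasoning
    smallRoot : Fin d → Fin (pred d)
    smallRoot t = fromℕ< (proj₁ (proj₂ (root-below-pred 2<d (toℕ<n (proj₁ (root t))))))
    smallRoot-square : ∀ t → toℕ (smallRoot t) * toℕ (smallRoot t) % d ≡ toℕ t
    smallRoot-square t with root t
    ... | s , s²≡t with root-below-pred 2<d (toℕ<n s)
    ... | r , r<pred , r²≡s² = begin
      toℕ (fromℕ< r<pred) * toℕ (fromℕ< r<pred) % d   ≡⟨ cong (λ k → k * k % d) (toℕ-fromℕ< r<pred) ⟩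
      r * r % d                                       ≡⟨ r²≡s² ⟩
      toℕ s * toℕ s % d                               ≡⟨ s²≡t ⟩
      toℕ t                                           ∎
    collision : ¬ ∃₂ λ i j → i <ᶠ j × smallRoot i ≡ smallRoot j
    collision (i , j , i<j , same) = <⇒≢ i<j (toℕ-injective (begin
      toℕ i                                         ≡⟨ smallRoot-square i ⟨
      toℕ (smallRoot i) * toℕ (smallRoot i) % d     ≡⟨ cong (λ r → toℕ r * toℕ r % d) same ⟩
      toℕ (smallRoot j) * toℕ (smallRoot j) % d     ≡⟨ smallRoot-square j ⟩
      toℕ j                                         ∎))

  ∃-nonResidue : 2 < d → ∃ (NonResidue d)
  ∃-nonResidue 2<d with any? (λ t → all? (λ s → ¬? (toℕ s * toℕ s % d ≟ toℕ {d} t)))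
  ... | yes (t , noRoot) = toℕ t , nonResidue
    where
    open ≡-Reasoning
    nonResidue : NonResidue d (toℕ t)
    nonResidue s s²≡t = noRoot (fromℕ< s%d<d) (begin
      toℕ (fromℕ< s%d<d) * toℕ (fromℕ< s%d<d) % d   ≡⟨ cong (λ k → k * k % d) (toℕ-fromℕ< s%d<d) ⟩
      s % d * (s % d) % d                           ≡⟨ %-distribˡ-* s s d ⟨
      s * s % d                                     ≡⟨ s²≡t ⟩
      toℕ t % d                                     ≡⟨ m<n⇒m%n≡m (toℕ<n t) ⟩
      toℕ t                                         ∎)
      where
      s%d<d : s % d < d
      s%d<d = m%n<n s d
  ... | no noNonResidue = ⊥-elim (¬squaring-surjective 2<d root)
    where
    root : ∀ (t : Fin d) → ∃ λ (s : Fin d) → toℕ s * toℕ s % d ≡ toℕ t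
    root t with ¬∀⟶∃¬ d _ (λ s → ¬? (toℕ s * toℕ s % d ≟ toℕ t))
                      (λ noRoot → noNonResidue (t , noRoot))
    ... | s , ¬¬root = s , decidable-stable (toℕ s * toℕ s % d ≟ toℕ t) ¬¬root

module _ {q : ℕ} .{{_ : NonZero q}} (q-prime : Prime q) where

  open Modulo q

  nonResidue⇒∤a*x+b*y : ∀ {t x u v a b y} → NonResidue q t → ¬ q ∣ x → Coprime v q →
                         a % q ≡ u * u % q → b % q ≡ v * v % q → y % q ≡ pred q * x * t % q →
                         ¬ q ∣ a * x + b * y
  nonResidue⇒∤a*x+b*y {t} {x} {u} {v} {a} {b} {y} nr q∤x v⊥q a≡u² b≡v² y≡-xt q∣ax+by
    with euclidsLemma x (u * u + pred q * (v * v * t)) q-prime q∣x[u²-v²t]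
    where
    factor : ∀ u v x t p → u * u * x + v * v * (p * x * t) ≡ x * (u * u + p * (v * v * t))
    factor = solve-∀
    q∣x[u²-v²t] : q ∣ x * (u * u + pred q * (v * v * t))
    q∣x[u²-v²t] = subst (q ∣_) (factor u v x t (pred q)) (∣-resp-%≡ reduce q∣ax+by)
      where
      reduce : (a * x + b * y) % q ≡ (u * u * x + v * v * (pred q * x * t)) % q
      reduce = %-cong-+ (%-cong-* a≡u² refl) (%-cong-* b≡v² y≡-xt)
  ... | inj₁ q∣x = q∤x q∣x
  ... | inj₂ q∣u²-v²t = nonResidue-coprimeSquare {u = u} nr v⊥q (d∣m+pred[d]*n⇒m%d≡n%d _ _ q∣u²-v²t)

∷ʳ-split : ∀ {A : Set} (X B S : List A) {y} → X ++ B ≡ S ++ [ y ] →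
           B ≡ [] ⊎ ∃ λ B′ → B ≡ B′ ++ [ y ] × S ≡ X ++ B′
∷ʳ-split []      B S       e = inj₂ (S , e , refl)
∷ʳ-split (_ ∷ X) B []      e = inj₁ (++-conicalʳ X B (∷-injectiveʳ e))
∷ʳ-split (a ∷ X) B (s ∷ S) e with refl , e′ ← ∷-injective e with ∷ʳ-split X B S e′
... | inj₁ B≡[]             = inj₁ B≡[]
... | inj₂ (B′ , B≡ , S≡)   = inj₂ (B′ , B≡ , cong (a ∷_) S≡)

suffix-split : ∀ {A : Set} (pre B P : List A) {x Q} → pre ++ B ≡ P ++ x ∷ Q →
               (∃ λ R → B ≡ R ++ x ∷ Q × P ≡ pre ++ R) ⊎ (∃ λ R → Q ≡ R ++ B)
suffix-split []        B P       e = inj₁ (P , e , refl)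
suffix-split (_ ∷ pre) B []      e = inj₂ (pre , sym (∷-injectiveʳ e))
suffix-split (p ∷ pre) B (_ ∷ P) e with refl , e′ ← ∷-injective e with suffix-split pre B P e′
... | inj₁ (R , B≡ , P≡) = inj₁ (R , B≡ , cong (p ∷_) P≡)
... | inj₂ Q≡            = inj₂ Q≡

module _ {n : ℕ} .{{_ : NonZero n}} where

  suffixBlock : ∀ {S : List (Fin n)} {y} → ¬ HasConsecZeroSum n S → HasConsecZeroSum n (S ++ [ y ]) →
                ∃₂ λ pre B → S ≡ pre ++ B × WeightedZeroSum n (B ++ [ y ])
  suffixBlock {S} {y} noBlock (pre , b , bs , post , e , zeroSum)
    with ∷ʳ-split (pre ++ b ∷ bs) post S (trans (++-assoc pre (b ∷ bs) post) (sym e))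
  ... | inj₂ (post′ , _ , S≡) =
    ⊥-elim (noBlock (pre , b , bs , post′ , trans S≡ (++-assoc pre (b ∷ bs) post′) , zeroSum))
  ... | inj₁ refl
    with ∷ʳ-split pre (b ∷ bs) S (trans (sym (++-identityʳ _)) (trans (++-assoc pre (b ∷ bs) []) (sym e)))
  ...   | inj₂ (B , b∷bs≡ , S≡) = pre , B , S≡ , subst (WeightedZeroSum n) b∷bs≡ zeroSum

  extremal⇒suffixBlock : ∀ {S} → Extremal n S → ∀ y →
                         ∃₂ λ pre B → S ≡ pre ++ B × WeightedZeroSum n (B ++ [ y ])
  extremal⇒suffixBlock {S} (_ , (_ , everyLength , _) , length≡ , noBlock) y =
    suffixBlock noBlock (everyLength (S ++ [ y ]) (trans (length-++ S) length≡))

MultipleOf : ∀ {n} → ℕ → Fin n → Set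
MultipleOf q z = q ∣ toℕ z

multipleOf? : ∀ {n} q (z : Fin n) → MultipleOf q z ⊎ ¬ MultipleOf q z
multipleOf? q z = toSum (q ∣? toℕ z)

weightedSum-dropMultiples : ∀ {n q} .{{_ : NonZero q}} {P : Fin n → Set} {zs : List (Fin n)} rest {ws} →
                            All (MultipleOf q) zs → All P ws → length ws ≡ length (zs ++ rest) →
                            ∃ λ ws′ → All P ws′ × length ws′ ≡ length rest ×
                                      weightedSum ws (zs ++ rest) % q ≡ weightedSum ws′ rest % q
weightedSum-dropMultiples rest []            Pws        len = _ , Pws , len , refl
weightedSum-dropMultiples rest (_ ∷ _)       []         ()
weightedSum-dropMultiples rest (q∣z ∷ q∣zs) (_∷_ {w} _ Pws) len
  with ws′ , Pws′ , len′ , ≡sum ← weightedSum-dropMultiples rest q∣zs Pws (suc-injective len) =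
  ws′ , Pws′ , len′ , trans (%-remove-+ˡ _ (∣n⇒∣m*n (toℕ w) q∣z)) ≡sum

module _ {n : ℕ} .{{_ : NonZero n}} {q : ℕ} .{{_ : NonZero q}} (q∣n : q ∣ n) where

  open Modulo q

  ∣-zeroSum : ∀ (as xs : List (Fin n)) → weightedSum as xs % n ≡ 0 → q ∣ weightedSum as xs
  ∣-zeroSum as xs ≡0 = ∣-trans q∣n (m%n≡0⇒n∣m (weightedSum as xs) n ≡0)

  unitSquare-residue : ∀ {b} → UnitSquare n b → ∃ λ v → Coprime v q × toℕ b % q ≡ v * v % q
  unitSquare-residue {b} (v , _ , v⊥n , b≡v²) = v , v⊥q , (begin
    toℕ b % q       ≡⟨ cong (_% q) b≡v² ⟩
    v * v % n % q   ≡⟨ m∣n⇒o%n%m≡o%m q n (v * v) q∣n ⟩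
    v * v % q       ∎)
    where
    open ≡-Reasoning
    v⊥q : Coprime v q
    v⊥q (i∣v , i∣q) = v⊥n (i∣v , ∣-trans i∣q q∣n)

  lastTerm-afterMultiples : ∀ {B y} → All (MultipleOf q) B → WeightedZeroSum n (B ++ [ y ]) →
                            ∃ λ b → UnitSquare n b × q ∣ toℕ b * toℕ y
  lastTerm-afterMultiples {B} {y} q∣B (as , len , squares , zeroSum)
    with weightedSum-dropMultiples [ y ] q∣B squares len
  ... | b ∷ [] , b-square ∷ [] , _ , ≡sum =
    b , b-square , subst (q ∣_) (+-identityʳ _) (∣-resp-%≡ ≡sum (∣-zeroSum as (B ++ [ y ]) zeroSum))

  lastTerms-afterOneCoprime : ∀ {R x Q y} → All (MultipleOf q) R → All (MultipleOf q) Q →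
                              WeightedZeroSum n (R ++ x ∷ Q ++ [ y ]) →
                              ∃₂ λ a b → UnitSquare n a × UnitSquare n b × q ∣ toℕ a * toℕ x + toℕ b * toℕ y
  lastTerms-afterOneCoprime {R} {x} {Q} {y} q∣R q∣Q (as , len , squares , zeroSum)
    with weightedSum-dropMultiples (x ∷ Q ++ [ y ]) q∣R squares len
  ... | a ∷ as′ , a-square ∷ squares′ , len′ , ≡sum
    with weightedSum-dropMultiples [ y ] q∣Q squares′ (suc-injective len′)
  ... | b ∷ [] , b-square ∷ [] , _ , ≡sum′ =
    a , b , a-square , b-square ,
    subst (λ s → q ∣ toℕ a * toℕ x + s) (+-identityʳ _)
      (∣-resp-%≡ (trans ≡sum (%-cong-+ refl ≡sum′)) (∣-zeroSum as (R ++ x ∷ Q ++ [ y ]) zeroSum))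

  module _ (q-prime : Prime q) (2<q : 2 < q) where

    record Obstructs (x : ℕ) (y : Fin n) : Set where
      field
        single : ∀ {b} → UnitSquare n b → ¬ q ∣ toℕ b * toℕ y
        pair   : ∀ {a b} → UnitSquare n a → UnitSquare n b → ¬ q ∣ toℕ a * x + toℕ b * toℕ y

    obstructingTerm : ∀ {x} → ¬ q ∣ x → ∃ (Obstructs x)
    obstructingTerm {x} q∤x = y , record { single = single ; pair = pair }
      where
      t : ℕ
      t = proj₁ (∃-nonResidue 2<q)
      t-nonResidue : NonResidue q t
      t-nonResidue = proj₂ (∃-nonResidue 2<q)
      -- pred q ≡ −1 (mod q)
      y : Fin n
      y = fromℕ< (m%n<n (pred q * x * t) n)
      y≡-xt : toℕ y % q ≡ pred q * x * t % q
      y≡-xt = trans (cong (_% q) (toℕ-fromℕ< _)) (m∣n⇒o%n%m≡o%m q n _ q∣n)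
      single : ∀ {b} → UnitSquare n b → ¬ q ∣ toℕ b * toℕ y
      single b-square with v , v⊥q , b≡v² ← unitSquare-residue b-square =
        nonResidue⇒∤a*x+b*y q-prime {u = 0} {a = 0} t-nonResidue q∤x v⊥q refl b≡v² y≡-xt
      pair : ∀ {a b} → UnitSquare n a → UnitSquare n b → ¬ q ∣ toℕ a * x + toℕ b * toℕ y
      pair a-square b-square
        with u , _ , a≡u² ← unitSquare-residue a-square
        with v , v⊥q , b≡v² ← unitSquare-residue b-square =
        nonResidue⇒∤a*x+b*y q-prime {u = u} t-nonResidue q∤x v⊥q a≡u² b≡v² y≡-xt

    extremal⇒¬allMultiples : ∀ {S} → Extremal n S → ¬ All (MultipleOf q) S
    extremal⇒¬allMultiples ext q∣S
      with y , obstructs ← obstructingTerm {1} (λ q∣1 → <⇒≱ 2<q (≤-trans (∣⇒≤ q∣1) (s≤s z≤n)))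
      with pre , B , refl , zeroSum ← extremal⇒suffixBlock ext y
      with b , b-square , q∣by ← lastTerm-afterMultiples (++⁻ʳ pre q∣S) zeroSum =
      Obstructs.single obstructs b-square q∣by

    extremal⇒¬oneCoprime : ∀ {P x Q} → Extremal n (P ++ x ∷ Q) →
                           All (MultipleOf q) P → ¬ MultipleOf q x → All (MultipleOf q) Q → ⊥
    extremal⇒¬oneCoprime {P} {x} {Q} ext q∣P q∤x q∣Q
      with y , obstructs ← obstructingTerm q∤x
      with pre , B , S≡pre++B , zeroSum ← extremal⇒suffixBlock ext y
      with suffix-split pre B P (sym S≡pre++B)
    ... | inj₁ (R , refl , refl) with a , b , a-square , b-square , q∣ax+by ←
            lastTerms-afterOneCoprime (++⁻ʳ pre q∣P) q∣Q
              (subst (WeightedZeroSum n) (++-assoc R (x ∷ Q) [ y ]) zeroSum) =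
      Obstructs.pair obstructs a-square b-square q∣ax+by
    ... | inj₂ (R , refl) with b , b-square , q∣by ← lastTerm-afterMultiples (++⁻ʳ R q∣Q) zeroSum =
      Obstructs.single obstructs b-square q∣by

atLeastTwoCoprime : ∀ {n} q (S : List (Fin n)) → ¬ All (MultipleOf q) S →
                    (∀ {P x Q} → P ++ x ∷ Q ≡ S →
                       All (MultipleOf q) P → ¬ MultipleOf q x → All (MultipleOf q) Q → ⊥) →
                    AtLeastTwoCoprime q S
atLeastTwoCoprime q S ¬all ¬one with first (multipleOf? q) S
... | inj₂ q∣S = ⊥-elim (¬all q∣S)
... | inj₁ fst with toView fst
... | FirstView._++_∷_ q∣P q∤x Q with first (multipleOf? q) Q
...   | inj₂ q∣Q = ⊥-elim (¬one refl q∣P q∤x q∣Q)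
...   | inj₁ fst′ with toView fst′
...   | FirstView._++_∷_ _ q∤x′ _ = _ , _ , _ , _ , _ , refl , q∤x , q∤x′

mainTheorem19 : (n : ℕ) .{{_ : NonZero n}} → 1 < n →
    ((p : ℕ) → Prime p → p ∣ n → 7 ≤ p) →
    (S : List (Fin n)) → Extremal n S →
    (q : ℕ) → Prime q → q ∣ n → AtLeastTwoCoprime q S
mainTheorem19 n _ primeDivisors≥7 S ext q q-prime q∣n =
  atLeastTwoCoprime q S (extremal⇒¬allMultiples q∣n q-prime 2<q ext)
    (λ { refl → extremal⇒¬oneCoprime q∣n q-prime 2<q ext })
  where
  instance _ = prime⇒nonZero q-prime
  2<q : 2 < q
  2<q = ≤-trans (s≤s (s≤s (s≤s z≤n))) (primeDivisors≥7 q q-prime q∣n)
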